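{- Let $k\ge2$, $\sigma\in\mathbb N$, $s\in\mathbb N_0$, and let $J^k_\sigma(s)=\{\Pi_A:A\in I^k_s,\ \operatorname{vol}\Pi_A=2^{ -\sigma}\}$. If $s\ge\sigma$, then $J^k_\sigma(s)$ does not depend on $s$, and, denoting it $J^k_\sigma$, $$|J^k_\sigma|\ge\Big(\frac{\sigma}{k-1}\Big)^{k-1}.$$
   Context: $I_s=\{0,1,\dots,s\}$ and $I_s^k$ its $k$-fold product. $\Pi_0=[0,1)$, $\Pi_a=[2^{ -a},2^{1-a})$ for $a\in\mathbb N$, and for $A=(a_1,\dots,a_k)\in\mathbb N_0^k$, $\Pi_A=\Pi_{a_1}\times\dots\times\Pi_{a_k}\subset[0,1)^k$, with volume $\operatorname{vol}\Pi_A=2^{ -a_1-\dots-a_k}$. -}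

module Defs where

open import Data.Nat using (ℕ; zero; suc; _≟_)
open import Data.List using (List; []; _∷_; map; concatMap; upTo; filter)
open import Data.Vec using (Vec; sum) renaming ([] to []ᵥ; _∷_ to _∷ᵥ_)

-- A multi-index A = (a₁,…,a_k) ∈ ℕ₀^k is represented as a vector 'Vec ℕ k'.
-- The box Π_A is determined by (and determines) A, and vol Π_A = 2^{-(a₁+…+a_k)},
-- so vol Π_A = 2^{-σ} iff sum A ≡ σ.

I^ : (s k : ℕ) → List (Vec ℕ k)
I^ s zero    = []ᵥ ∷ []
I^ s (suc k) = concatMap (λ a → map (a ∷ᵥ_) (I^ s k)) (upTo (suc s))

J : (k σ s : ℕ) → List (Vec ℕ k)
J k σ s = filter (λ A → sum A ≟ σ) (I^ s k)

{-# OPTIONS --safe #-}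
-- A vector of sum σ ≤ s has all its entries in I_s, so J k σ s lists exactly the A ∈ ℕ^k with
-- sum A = σ, whatever s ≥ σ. Their number, the weak compositions of σ into k parts, obeys
-- Pascal's rule (split on whether the first entry is 0), whence m! σ! · #{A ∈ ℕ^(m+1) : sum A = σ}
-- = (m + σ)!, i.e. the count is C(σ + m, m) = ∏_{j=1}^m (σ + j)/j. Each factor is at least σ/m,
-- because σ j ≤ m (σ + j) for j ≤ m.
module Submission where

open import Defs
open import Data.Bool using (true; false)
open import Data.List using (List; []; _∷_; _++_; length; map; concatMap; filter; upTo; applyUpTo)
open import Data.List.Membership.Propositional using (_∈_; lose)
open import Data.List.Membership.Propositional.Properties
  using (∈-map⁺; ∈-concatMap⁺; ∈-upTo⁺; ∈-filter⁺; ∈-filter⁻)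
open import Data.List.Properties using (length-++; filter-++; filter-≐; filter-none; map-upTo)
open import Data.List.Relation.Unary.All as ListAll using ()
open import Data.List.Relation.Unary.Any using (here)
open import Data.Nat using (ℕ; zero; suc; _+_; _*_; _^_; _∸_; _!; _≤_; _<_; _≟_; z≤n; s≤s)
open import Data.Nat.ListAction using (sum)
open import Data.Nat.Properties
open import Data.Nat.Tactic.RingSolver using (solve-∀)
open import Data.Product using (_×_; _,_; proj₂)
open import Data.Vec using (Vec; []; _∷_) renaming (sum to sumᵥ)
open import Data.Vec.Relation.Unary.All using (All; []; _∷_)
open import Function using (_∘_)
open import Function.Bundles using (_⇔_; mk⇔)
open import Function.Properties.Equivalence as ⇔ using ()
open import Relation.Binary.PropositionalEquality
  using (_≡_; _≢_; refl; sym; trans; cong; cong₂; module ≡-Reasoning)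
open import Relation.Nullary using (does)
open import Relation.Unary using (Pred; Decidable)

module _ {a b p} {A : Set a} {B : Set b} {P : Pred A p} (P? : Decidable P) where

  length-filter-map : (f : B → A) (xs : List B) →
    length (filter P? (map f xs)) ≡ length (filter (P? ∘ f) xs)
  length-filter-map f [] = refl
  length-filter-map f (x ∷ xs) with does (P? (f x))
  ... | true  = cong suc (length-filter-map f xs)
  ... | false = length-filter-map f xs

  length-filter-concatMap : (f : B → List A) (xs : List B) →
    length (filter P? (concatMap f xs)) ≡ sum (map (length ∘ filter P? ∘ f) xs)
  length-filter-concatMap f [] = refl
  length-filter-concatMap f (x ∷ xs) = begin
    length (filter P? (f x ++ concatMap f xs))
      ≡⟨ cong length (filter-++ P? (f x) (concatMap f xs)) ⟩
    length (filter P? (f x) ++ filter P? (concatMap f xs))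
      ≡⟨ length-++ (filter P? (f x)) ⟩
    length (filter P? (f x)) + length (filter P? (concatMap f xs))
      ≡⟨ cong (length (filter P? (f x)) +_) (length-filter-concatMap f xs) ⟩
    sum (map (length ∘ filter P? ∘ f) (x ∷ xs)) ∎
    where open ≡-Reasoning

sum-applyUpTo-restrict : ∀ {f g : ℕ → ℕ} {m n} → n ≤ m →
  (∀ {i} → i < n → f i ≡ g i) → (∀ {i} → n ≤ i → f i ≡ 0) →
  sum (applyUpTo f m) ≡ sum (applyUpTo g n)
sum-applyUpTo-restrict         {m = zero}  z≤n _ _      = refl
sum-applyUpTo-restrict {g = g} {m = suc m} z≤n _ vanish =
  cong₂ _+_ (vanish z≤n) (sum-applyUpTo-restrict {g = g} {m = m} z≤n (λ ()) (λ _ → vanish z≤n))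
sum-applyUpTo-restrict (s≤s n≤m) agree vanish =
  cong₂ _+_ (agree (s≤s z≤n)) (sum-applyUpTo-restrict n≤m (agree ∘ s≤s) (vanish ∘ s≤s))

sum≤⇒All≤ : ∀ {k s} (A : Vec ℕ k) → sumᵥ A ≤ s → All (_≤ s) A
sum≤⇒All≤ []      _ = []
sum≤⇒All≤ (a ∷ A) a+ΣA≤s =
  ≤-trans (m≤m+n a (sumᵥ A)) a+ΣA≤s ∷ sum≤⇒All≤ A (≤-trans (m≤n+m (sumᵥ A) a) a+ΣA≤s)

∈-I^ : ∀ {k s} {A : Vec ℕ k} → All (_≤ s) A → A ∈ I^ s k
∈-I^ []                     = here refl
∈-I^ {A = a ∷ _} (a≤s ∷ A≤s) =
  ∈-concatMap⁺ _ (lose (∈-upTo⁺ (s≤s a≤s)) (∈-map⁺ (a ∷_) (∈-I^ A≤s)))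

∈-J⇔ : ∀ {k σ s} {A : Vec ℕ k} → σ ≤ s → (A ∈ J k σ s) ⇔ (sumᵥ A ≡ σ)
∈-J⇔ {k} {σ} {s} {A} σ≤s = mk⇔
  (proj₂ ∘ ∈-filter⁻ (λ A → sumᵥ A ≟ σ) {xs = I^ s k})
  (λ ΣA≡σ → ∈-filter⁺ (λ A → sumᵥ A ≟ σ) (∈-I^ (sum≤⇒All≤ A (≤-trans (≤-reflexive ΣA≡σ) σ≤s))) ΣA≡σ)

weakCompositions : ℕ → ℕ → ℕ
weakCompositions zero    zero    = 1
weakCompositions zero    (suc _) = 0
weakCompositions (suc k) σ       = sum (applyUpTo (λ a → weakCompositions k (σ ∸ a)) (suc σ))

length-J : ∀ k {σ s} → σ ≤ s → length (J k σ s) ≡ weakCompositions k σ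
length-J zero    {zero}      _   = refl
length-J zero    {suc _}     _   = refl
length-J (suc k) {σ}     {s} σ≤s = begin
  length (J (suc k) σ s)
    ≡⟨ length-filter-concatMap (λ A → sumᵥ A ≟ σ) withHead (upTo (suc s)) ⟩
  sum (map countWithHead (upTo (suc s)))
    ≡⟨ cong sum (map-upTo countWithHead (suc s)) ⟩
  sum (applyUpTo countWithHead (suc s))
    ≡⟨ sum-applyUpTo-restrict (s≤s σ≤s) (λ { (s≤s a≤σ) → countWithHead-≤ a≤σ }) countWithHead-> ⟩
  weakCompositions (suc k) σ ∎
  where
  open ≡-Reasoning
  withHead : ℕ → List (Vec ℕ (suc k))
  withHead a = map (a ∷_) (I^ s k)

  countWithHead : ℕ → ℕ
  countWithHead = length ∘ filter (λ A → sumᵥ A ≟ σ) ∘ withHead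

  countWithHead≡ : ∀ a → countWithHead a ≡ length (filter (λ A → a + sumᵥ A ≟ σ) (I^ s k))
  countWithHead≡ a = length-filter-map (λ A → sumᵥ A ≟ σ) (a ∷_) (I^ s k)

  countWithHead-≤ : ∀ {a} → a ≤ σ → countWithHead a ≡ weakCompositions k (σ ∸ a)
  countWithHead-≤ {a} a≤σ = begin
    countWithHead a
      ≡⟨ countWithHead≡ a ⟩
    length (filter (λ A → a + sumᵥ A ≟ σ) (I^ s k))
      ≡⟨ cong length (filter-≐ (λ A → a + sumᵥ A ≟ σ) (λ A → sumᵥ A ≟ σ ∸ a)
                                     ((λ {A} → subtract {A}) , (λ {A} → add {A})) (I^ s k)) ⟩
    length (J k (σ ∸ a) s)
      ≡⟨ length-J k (≤-trans (m∸n≤m σ a) σ≤s) ⟩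
    weakCompositions k (σ ∸ a) ∎
    where
    subtract : ∀ {A : Vec ℕ k} → a + sumᵥ A ≡ σ → sumᵥ A ≡ σ ∸ a
    subtract {A} eq = trans (sym (m+n∸m≡n a (sumᵥ A))) (cong (_∸ a) eq)
    add : ∀ {A : Vec ℕ k} → sumᵥ A ≡ σ ∸ a → a + sumᵥ A ≡ σ
    add eq = trans (cong (a +_) eq) (m+[n∸m]≡n a≤σ)

  countWithHead-> : ∀ {a} → suc σ ≤ a → countWithHead a ≡ 0
  countWithHead-> {a} σ<a =
    trans (countWithHead≡ a) (cong length (filter-none _ (ListAll.universal tooBig (I^ s k))))
    where
    tooBig : ∀ (A : Vec ℕ k) → a + sumᵥ A ≢ σ
    tooBig A eq = <⇒≱ σ<a (≤-trans (m≤m+n a (sumᵥ A)) (≤-reflexive eq))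

weakCompositions-pascal : ∀ k σ →
  weakCompositions (suc k) (suc σ) ≡ weakCompositions k (suc σ) + weakCompositions (suc k) σ
weakCompositions-pascal k σ = refl

weakCompositions-one : ∀ σ → weakCompositions 1 σ ≡ 1
weakCompositions-one zero    = refl
weakCompositions-one (suc σ) = weakCompositions-one σ

weakCompositions-zero : ∀ k → weakCompositions k 0 ≡ 1
weakCompositions-zero zero    = refl
weakCompositions-zero (suc k) = trans (+-identityʳ (weakCompositions k 0)) (weakCompositions-zero k)

weakCompositions-factorial : ∀ m σ → m ! * σ ! * weakCompositions (suc m) σ ≡ (m + σ) !
weakCompositions-factorial zero σ = begin
  1 * σ ! * weakCompositions 1 σ ≡⟨ cong (1 * σ ! *_) (weakCompositions-one σ) ⟩
  1 * σ ! * 1                    ≡⟨ *-identityʳ (1 * σ !) ⟩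
  1 * σ !                        ≡⟨ *-identityˡ (σ !) ⟩
  σ !                            ∎
  where open ≡-Reasoning
weakCompositions-factorial (suc m) zero = begin
  suc m ! * 1 * weakCompositions (suc (suc m)) 0
    ≡⟨ cong (suc m ! * 1 *_) (weakCompositions-zero (suc (suc m))) ⟩
  suc m ! * 1 * 1
    ≡⟨ trans (*-identityʳ (suc m ! * 1)) (*-identityʳ (suc m !)) ⟩
  suc m !
    ≡⟨ cong _! (sym (+-identityʳ (suc m))) ⟩
  (suc m + 0) !
    ∎
  where open ≡-Reasoning
weakCompositions-factorial (suc m) (suc σ) = begin
  suc m ! * suc σ ! * weakCompositions (suc (suc m)) (suc σ)
    ≡⟨ cong (suc m ! * suc σ ! *_) (weakCompositions-pascal (suc m) σ) ⟩
  suc m ! * suc σ ! * (weakCompositions (suc m) (suc σ) + weakCompositions (suc (suc m)) σ)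
    ≡⟨ regroup m σ (m !) (σ !) _ _ ⟩
  suc m * (m ! * suc σ ! * weakCompositions (suc m) (suc σ))
    + suc σ * (suc m ! * σ ! * weakCompositions (suc (suc m)) σ)
    ≡⟨ cong₂ (λ x y → suc m * x + suc σ * y)
             (weakCompositions-factorial m (suc σ)) (weakCompositions-factorial (suc m) σ) ⟩
  suc m * (m + suc σ) ! + suc σ * (suc m + σ) !
    ≡⟨ cong (λ n → suc m * (m + suc σ) ! + suc σ * n !) (sym (+-suc m σ)) ⟩
  suc m * (m + suc σ) ! + suc σ * (m + suc σ) !
    ≡⟨ sym (*-distribʳ-+ ((m + suc σ) !) (suc m) (suc σ)) ⟩
  (suc m + suc σ) !
    ∎
  where
  open ≡-Reasoning
  regroup : ∀ p q x y a b → (suc p * x) * (suc q * y) * (a + b)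
                            ≡ suc p * (x * (suc q * y) * a) + suc q * ((suc p * x) * y * b)
  regroup = solve-∀

factor-bound : ∀ {m n} σ → n ≤ m → σ * n ≤ m * (n + σ)
factor-bound {m} {n} σ n≤m = begin
  σ * n       ≤⟨ *-monoʳ-≤ σ n≤m ⟩
  σ * m       ≡⟨ *-comm σ m ⟩
  m * σ       ≤⟨ *-monoʳ-≤ m (m≤n+m σ n) ⟩
  m * (n + σ) ∎
  where open ≤-Reasoning

factorial-bound : ∀ {m n} σ → n ≤ m → σ ^ n * (n ! * σ !) ≤ m ^ n * (n + σ) !
factorial-bound {m} {zero} σ _ = ≤-reflexive (cong (1 *_) (*-identityˡ (σ !)))
factorial-bound {m} {suc n} σ n<m = begin
  σ ^ suc n * (suc n ! * σ !)             ≡⟨ split σ (σ ^ n) (suc n) (n !) (σ !) ⟩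
  σ * suc n * (σ ^ n * (n ! * σ !))       ≤⟨ *-mono-≤ (factor-bound σ n<m) (factorial-bound σ (<⇒≤ n<m)) ⟩
  m * (suc n + σ) * (m ^ n * (n + σ) !)   ≡⟨ merge m (m ^ n) (suc n + σ) ((n + σ) !) ⟩
  m ^ suc n * (suc n + σ) !               ∎
  where
  open ≤-Reasoning
  split : ∀ x xⁿ y f g → x * xⁿ * (y * f * g) ≡ x * y * (xⁿ * (f * g))
  split = solve-∀
  merge : ∀ x xⁿ y z → x * y * (xⁿ * z) ≡ x * xⁿ * (y * z)
  merge = solve-∀

weakCompositions-lower-bound : ∀ m σ → σ ^ m ≤ m ^ m * weakCompositions (suc m) σ
weakCompositions-lower-bound m σ =
  *-cancelʳ-≤ (σ ^ m) (m ^ m * weakCompositions (suc m) σ) (m ! * σ !) {{m !* σ !≢0}} (begin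
    σ ^ m * (m ! * σ !)
      ≤⟨ factorial-bound σ (≤-refl {m}) ⟩
    m ^ m * (m + σ) !
      ≡⟨ cong (m ^ m *_) (weakCompositions-factorial m σ) ⟨
    m ^ m * (m ! * σ ! * weakCompositions (suc m) σ)
      ≡⟨ regroup (m ^ m) (m ! * σ !) (weakCompositions (suc m) σ) ⟩
    m ^ m * weakCompositions (suc m) σ * (m ! * σ !)
      ∎)
  where
  open ≤-Reasoning
  regroup : ∀ x y z → x * (y * z) ≡ x * z * y
  regroup = solve-∀

lemma6p3 : (k σ : ℕ) → 2 ≤ k → 1 ≤ σ →
    ((s s′ : ℕ) → σ ≤ s → σ ≤ s′ → (A : Vec ℕ k) → (A ∈ J k σ s) ⇔ (A ∈ J k σ s′))
    × ((s : ℕ) → σ ≤ s → σ ^ (k ∸ 1) ≤ (k ∸ 1) ^ (k ∸ 1) * length (J k σ s))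
-- The bound holds for σ = 0 too, and 2 ≤ k is only needed as k ≥ 1.
lemma6p3 (suc m) σ (s≤s _) _ = independent , bounded
  where
  independent : (s s′ : ℕ) → σ ≤ s → σ ≤ s′ →
                (A : Vec ℕ (suc m)) → (A ∈ J (suc m) σ s) ⇔ (A ∈ J (suc m) σ s′)
  independent s s′ σ≤s σ≤s′ A = ⇔.trans (∈-J⇔ σ≤s) (⇔.sym (∈-J⇔ σ≤s′))

  bounded : (s : ℕ) → σ ≤ s → σ ^ m ≤ m ^ m * length (J (suc m) σ s)
  bounded s σ≤s = begin
    σ ^ m                              ≤⟨ weakCompositions-lower-bound m σ ⟩
    m ^ m * weakCompositions (suc m) σ ≡⟨ cong (m ^ m *_) (length-J (suc m) σ≤s) ⟨
    m ^ m * length (J (suc m) σ s)     ∎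
    where open ≤-Reasoning
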